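{- Every tribe with stable path objects $(\mathsf{C}, \mathcal{A})$ admits a weak factorization system $(\mathcal{L}, \mathcal{R})$, where $\mathcal{L}$ is the class of arrows having the left lifting property with respect to every arrow in $\mathcal{A}$, and $\mathcal{R}$ is the class of arrows having the right lifting property with respect to every arrow in $\mathcal{L}$.
   Context: An arrow $f$ has the left lifting property (l.l.p.) with respect to $g$ (equivalently $g$ has the right lifting property (r.l.p.) with respect to $f$) if every commutative square with $f$ on the left and $g$ on the right admits a diagonal filler making both triangles commute. A weak factorization system on $\mathsf{C}$ is a pair of classes $(\mathcal{L},\mathcal{R})$ such that every arrow factors as $p\,i$ with $i\in\mathcal{L}$, $p\in\mathcal{R}$, and $\mathcal{R}$ is exactly the class of arrows with the r.l.p. with respect to all arrows of $\mathcal{L}$, while $\mathcal{L}$ is exactly the class of arrows with the l.l.p. with respect to all arrows of $\mathcal{R}$. A tribe is a pair $(\mathsf{C},\mathcal{A})$ where $\mathsf{C}$ has a terminal object $\mathbf{1}$ and $\mathcal{A}$ is a class of arrows such that: (a) for every pair of arrows with the same codomain, at least one of which is in $\mathcal{A}$, there is a chosen pullback square; (b) $\mathcal{A}$ is closed under composition and base change; (c) all isomorphisms and all arrows into $\mathbf{1}$ are in $\mathcal{A}$. The tribe has path objects if for every $p\colon E\to Y$ in $\mathcal{A}$ there is a chosen factorization of the diagonal $\Delta_p=\langle \mathrm{id}_E,\mathrm{id}_E\rangle\colon E\to E\times_p E$ as $\mathrm{r}_p\colon E\to \mathrm{Path}(p)$ followed by $\partial_p\colon \mathrm{Path}(p)\to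 E\times_p E$, such that $\partial_p\in\mathcal{A}$ and every base change of $\mathrm{r}_p$ along an arrow of $\mathcal{A}$ has the l.l.p. with respect to every arrow of $\mathcal{A}$. Write $\partial^0_p,\partial^1_p$ for the two components of $\partial_p$. For $g\colon X\to E$ and $p\colon E\to Y$ in $\mathcal{A}$, the mapping path object $\mathrm{Map}_p(g)$ is the pullback of $g$ along $\partial^0_p$, with projections $\mathrm{pm}_0\colon \mathrm{Map}_p(g)\to X$ and $\mathrm{pm}_1\colon \mathrm{Map}_p(g)\to \mathrm{Path}(p)$. The tribe with path objects has stable path objects if for every $p\colon E\to Y$ in $\mathcal{A}$ and every $f\colon X\to Y$, letting $F$ be the pullback of $f$ and $p$ with base-change arrows $f^*p\colon F\to X$ (in $\mathcal{A}$) and $p^*f\colon F\to E$, there exists an arrow $i\colon \mathrm{Map}_p(p^*f)\to \mathrm{Path}(f^*p)$ with $i\circ\langle \mathrm{id}_F,\mathrm{r}_p\, p^*f\rangle=\mathrm{r}_{f^*p}$ and $\partial_{f^*p}\circ i=\langle \mathrm{pm}_0,\langle (f^*p)\,\mathrm{pm}_0,\ \partial^1_p\,\mathrm{pm}_1\rangle\rangle\colon \mathrm{Map}_p(p^*f)\to F\times_{f^*p}F$. -}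

module Defs where

open import Level using (Level; _⊔_; suc)
open import Data.Product using (Σ; _×_; _,_; proj₁; proj₂; Σ-syntax)
open import Relation.Binary.PropositionalEquality using (_≡_; sym)

record Category (o ℓ : Level) : Set (suc (o ⊔ ℓ)) where
  infixr 9 _∘_
  field
    Obj  : Set o
    Hom  : Obj → Obj → Set ℓ
    id   : ∀ {X} → Hom X X
    _∘_  : ∀ {X Y Z} → Hom Y Z → Hom X Y → Hom X Z
    assoc : ∀ {W X Y Z} (h : Hom Y Z) (g : Hom X Y) (f : Hom W X) →
            (h ∘ g) ∘ f ≡ h ∘ (g ∘ f)
    identityˡ : ∀ {X Y} (f : Hom X Y) → id ∘ f ≡ f
    identityʳ : ∀ {X Y} (f : Hom X Y) → f ∘ id ≡ f

module _ {o ℓ : Level} (C : Category o ℓ) where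
  open Category C

  ArrowClass : (p : Level) → Set (o ⊔ ℓ ⊔ suc p)
  ArrowClass p = ∀ {X Y} → Hom X Y → Set p

  LLP : ∀ {A B X Y} → Hom A B → Hom X Y → Set ℓ
  LLP {A} {B} {X} {Y} f g =
    (u : Hom A X) (v : Hom B Y) → g ∘ u ≡ v ∘ f →
    Σ[ d ∈ Hom B X ] ((d ∘ f ≡ u) × (g ∘ d ≡ v))

  LLP-class : ∀ {p} → ArrowClass p → ArrowClass (o ⊔ ℓ ⊔ p)
  LLP-class 𝒦 f = ∀ {X Y} (g : Hom X Y) → 𝒦 g → LLP f g

  RLP-class : ∀ {p} → ArrowClass p → ArrowClass (o ⊔ ℓ ⊔ p)
  RLP-class 𝒦 g = ∀ {A B} (f : Hom A B) → 𝒦 f → LLP f g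

  record IsWFS {p q} (𝓛 : ArrowClass p) (𝓡 : ArrowClass q)
      : Set (o ⊔ ℓ ⊔ suc (p ⊔ q)) where
    field
      factor : ∀ {X Y} (f : Hom X Y) →
        Σ[ Z ∈ Obj ] Σ[ i ∈ Hom X Z ] Σ[ r ∈ Hom Z Y ]
          (𝓛 i × 𝓡 r × (r ∘ i ≡ f))
      𝓡⇒rlp : ∀ {X Y} (g : Hom X Y) → 𝓡 g → RLP-class 𝓛 g
      rlp⇒𝓡 : ∀ {X Y} (g : Hom X Y) → RLP-class 𝓛 g → 𝓡 g
      𝓛⇒llp : ∀ {X Y} (f : Hom X Y) → 𝓛 f → LLP-class 𝓡 f
      llp⇒𝓛 : ∀ {X Y} (f : Hom X Y) → LLP-class 𝓡 f → 𝓛 f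

  IsIso : ∀ {X Y} → Hom X Y → Set ℓ
  IsIso {X} {Y} f = Σ[ g ∈ Hom Y X ] ((g ∘ f ≡ id) × (f ∘ g ≡ id))

  record Terminal : Set (o ⊔ ℓ) where
    field
      𝟏 : Obj
      ! : ∀ {X} → Hom X 𝟏
      !-unique : ∀ {X} (h : Hom X 𝟏) → h ≡ !

  record Pullback {X Y Z} (f : Hom X Z) (g : Hom Y Z) : Set (o ⊔ ℓ) where
    field
      P  : Obj
      π₁ : Hom P X
      π₂ : Hom P Y
      commute : f ∘ π₁ ≡ g ∘ π₂
      universal : ∀ {W} (h : Hom W X) (k : Hom W Y) → f ∘ h ≡ g ∘ k →
        Σ[ u ∈ Hom W P ] ((π₁ ∘ u ≡ h) × (π₂ ∘ u ≡ k) ×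
          (∀ (u' : Hom W P) → π₁ ∘ u' ≡ h → π₂ ∘ u' ≡ k → u' ≡ u))

  flipPullback : ∀ {X Y Z} {f : Hom X Z} {g : Hom Y Z} → Pullback f g → Pullback g f
  flipPullback Q = record
    { P = P ; π₁ = π₂ ; π₂ = π₁ ; commute = sym commute
    ; universal = λ h k e → let (u , e₁ , e₂ , un) = universal k h (sym e)
                            in u , e₂ , e₁ , λ u' a b → un u' b a }
    where open Pullback Q

record Tribe (o ℓ a : Level) : Set (suc (o ⊔ ℓ ⊔ a)) where
  field
    C : Category o ℓ
  open Category C
  field
    terminal : Terminal C
    𝒜 : ArrowClass C a
    pb : ∀ {E Y X} (p : Hom E Y) → 𝒜 p → (f : Hom X Y) → Pullback C p f
    𝒜-∘ : ∀ {X Y Z} {g : Hom Y Z} {f : Hom X Y} → 𝒜 g → 𝒜 f → 𝒜 (g ∘ f)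
    𝒜-pb : ∀ {E Y X} (p : Hom E Y) → 𝒜 p → (f : Hom X Y) →
           (Q : Pullback C p f) → 𝒜 (Pullback.π₂ Q)
    𝒜-iso : ∀ {X Y} (f : Hom X Y) → IsIso C f → 𝒜 f
    𝒜-! : ∀ {X} (h : Hom X (Terminal.𝟏 terminal)) → 𝒜 h

module _ {o ℓ a} (T : Tribe o ℓ a) where
  open Tribe T
  open Category C

  𝓛 : ArrowClass C (o ⊔ ℓ ⊔ a)
  𝓛 = LLP-class C 𝒜

  𝓡 : ArrowClass C (o ⊔ ℓ ⊔ a)
  𝓡 = RLP-class C 𝓛

  _×ₚ_ : ∀ {E Y} (p : Hom E Y) → 𝒜 p → Pullback C p p
  p ×ₚ ap = pb p ap p

  -- A path object for p ∈ 𝒜: factorization  E --r--> Path(p) --∂--> E ×_p E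
  -- of the diagonal, stated componentwise (∂ ∘ r = ⟨id,id⟩).
  record PathObject {E Y} (p : Hom E Y) (ap : 𝒜 p) : Set (o ⊔ ℓ ⊔ a) where
    open Pullback (p ×ₚ ap) renaming (P to E×E; π₁ to pr₀; π₂ to pr₁)
    field
      Path : Obj
      r    : Hom E Path
      ∂    : Hom Path E×E
      ∂∘r-0 : pr₀ ∘ (∂ ∘ r) ≡ id
      ∂∘r-1 : pr₁ ∘ (∂ ∘ r) ≡ id
      ∂∈𝒜  : 𝒜 ∂
      -- every base change of r along an arrow of 𝒜 has the l.l.p. w.r.t. 𝒜
      -- (base change of r along q : Z → Path is the projection to Z)
      r-stable : ∀ {Z} (q : Hom Z Path) → 𝒜 q → (Q : Pullback C q r) →
                 𝓛 (Pullback.π₁ Q)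
    ∂⁰ : Hom Path E
    ∂⁰ = pr₀ ∘ ∂
    ∂¹ : Hom Path E
    ∂¹ = pr₁ ∘ ∂
    ∂⁰∈𝒜 : 𝒜 ∂⁰
    ∂⁰∈𝒜 = 𝒜-∘ (𝒜-pb p ap p (flipPullback C (p ×ₚ ap))) ∂∈𝒜

  HasPathObjects : Set (o ⊔ ℓ ⊔ a)
  HasPathObjects = ∀ {E Y} (p : Hom E Y) (ap : 𝒜 p) → PathObject p ap

  StablePathObjects : HasPathObjects → Set (o ⊔ ℓ ⊔ a)
  StablePathObjects PO =
    ∀ {E Y X} (p : Hom E Y) (ap : 𝒜 p) (f : Hom X Y) →
    let F    = pb p ap f
        open Pullback F renaming (P to Fo; π₁ to p*f; π₂ to f*p)
        af*p = 𝒜-pb p ap f F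
        Pp   = PO p ap
        Pf   = PO f*p af*p
        -- Map_p(p*f): pullback of p*f along ∂⁰_p; pm₁ to Path(p), pm₀ to F
        M    = pb (PathObject.∂⁰ Pp) (PathObject.∂⁰∈𝒜 Pp) p*f
        open Pullback M renaming (P to Mo; π₁ to pm₁; π₂ to pm₀)
        FF   = f*p ×ₚ af*p
        open Pullback FF renaming (π₁ to fst; π₂ to snd)
    in Σ[ i ∈ Hom Mo (PathObject.Path Pf) ]
       ( -- i ∘ ⟨id_F , r_p ∘ p*f⟩ = r_{f*p}
         (∀ (m : Hom Fo Mo) → pm₀ ∘ m ≡ id →
            pm₁ ∘ m ≡ PathObject.r Pp ∘ p*f →
            i ∘ m ≡ PathObject.r Pf)
       × -- ∂_{f*p} ∘ i = ⟨pm₀ , ⟨f*p ∘ pm₀ , ∂¹_p ∘ pm₁⟩⟩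
         (fst ∘ (PathObject.∂ Pf ∘ i) ≡ pm₀)
       × (f*p ∘ (snd ∘ (PathObject.∂ Pf ∘ i)) ≡ f*p ∘ pm₀)
       × (p*f ∘ (snd ∘ (PathObject.∂ Pf ∘ i)) ≡ PathObject.∂¹ Pp ∘ pm₁))

module Submission where

-- The two closure conditions of a weak factorization system hold by
-- definition of 𝓛 and 𝓡 (using 𝒜 ⊆ 𝓡), so the content is the factorization.
-- An arrow f : X → Y is factored through the mapping path object
--   M = X ×_Y Path(Y)   (paths in Y starting in the image of f)
-- as  X --i--> M --q--> Y,  i x = (constant path at f x , x),  q = endpoint.
--   * q ∈ 𝓡: a lifting problem against q is solved by lifting first against
--     X → 𝟏 and then against the boundary map ∂ : Path(Y) → Y × Y, both in 𝒜.
--   * i ∈ 𝓛: i is a strong deformation retract of M (general lemma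
--     `retract⇒𝓛`, proved by transporting along paths in the fibres of an
--     𝒜-arrow, `Transport`).  The deforming homotopy is obtained from the
--     stability of path objects, applied to a contraction of Path(Y) onto its
--     constant paths (`Contraction`).

open import Defs
open import Level using (Level)
open import Data.Product using (Σ; _×_; _,_; proj₁; proj₂; Σ-syntax)
open import Relation.Binary.PropositionalEquality
  using (_≡_; refl; sym; trans; cong; module ≡-Reasoning)

module PullbackLemmas {o ℓ : Level} (C : Category o ℓ) where
  open Category C

  pullˡ : ∀ {W X Y Z} {f : Hom Y Z} {g : Hom X Y} {h : Hom X Z} (k : Hom W X) →
          f ∘ g ≡ h → f ∘ (g ∘ k) ≡ h ∘ k
  pullˡ k e = trans (sym (assoc _ _ k)) (cong (_∘ k) e)

  module _ {X Y Z} {f : Hom X Z} {g : Hom Y Z} (Q : Pullback C f g) where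
    open Pullback Q

    pair : ∀ {W} (h : Hom W X) (k : Hom W Y) → f ∘ h ≡ g ∘ k → Hom W P
    pair h k e = proj₁ (universal h k e)

    pair-π₁ : ∀ {W} (h : Hom W X) (k : Hom W Y) (e : f ∘ h ≡ g ∘ k) → π₁ ∘ pair h k e ≡ h
    pair-π₁ h k e = proj₁ (proj₂ (universal h k e))

    pair-π₂ : ∀ {W} (h : Hom W X) (k : Hom W Y) (e : f ∘ h ≡ g ∘ k) → π₂ ∘ pair h k e ≡ k
    pair-π₂ h k e = proj₁ (proj₂ (proj₂ (universal h k e)))

    pb-ext : ∀ {W} {u v : Hom W P} → π₁ ∘ u ≡ π₁ ∘ v → π₂ ∘ u ≡ π₂ ∘ v → u ≡ v
    pb-ext {u = u} {v} e₁ e₂ = trans (unique u refl refl) (sym (unique v (sym e₁) (sym e₂)))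
      where
      cone : f ∘ (π₁ ∘ u) ≡ g ∘ (π₂ ∘ u)
      cone = trans (pullˡ u commute) (assoc _ _ _)
      unique = proj₂ (proj₂ (proj₂ (universal (π₁ ∘ u) (π₂ ∘ u) cone)))

    -- A lifting problem of i against g with bottom side v amounts to a section
    -- of the base change π₂ of g along v which agrees with u on i.
    section⇒lift : ∀ {X′} (u : Hom X′ X) (i : Hom X′ Y) (s : Hom Y P) →
      π₂ ∘ s ≡ id → π₁ ∘ (s ∘ i) ≡ u →
      Σ[ d ∈ Hom Y X ] ((d ∘ i ≡ u) × (f ∘ d ≡ g))
    section⇒lift u i s s-section s-extends =
      π₁ ∘ s , trans (assoc _ _ _) s-extends , lifts
      where
      open ≡-Reasoning
      lifts : f ∘ (π₁ ∘ s) ≡ g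
      lifts = begin
        f ∘ (π₁ ∘ s) ≡⟨ pullˡ s commute ⟩
        (g ∘ π₂) ∘ s ≡⟨ assoc _ _ _ ⟩
        g ∘ (π₂ ∘ s) ≡⟨ cong (g ∘_) s-section ⟩
        g ∘ id       ≡⟨ identityʳ g ⟩
        g            ∎

  idPullback : ∀ {A B} (r : Hom A B) → Pullback C (id {B}) r
  idPullback r = record
    { P = _ ; π₁ = r ; π₂ = id
    ; commute = trans (identityˡ r) (sym (identityʳ r))
    ; universal = λ h k e → k , trans (sym e) (identityˡ h) , identityˡ k ,
                  λ u′ _ e₂ → trans (sym (identityˡ u′)) e₂ }

module PathObjectLemmas {o ℓ a : Level} (T : Tribe o ℓ a) where
  open Tribe T
  open Category C
  open PullbackLemmas C
  open ≡-Reasoning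

  module PathObjectFacts {E Z} {p : Hom E Z} {ap : 𝒜 p} (Pp : PathObject T p ap) where
    open PathObject Pp public

    ∂⁰∘r : ∂⁰ ∘ r ≡ id
    ∂⁰∘r = trans (assoc _ _ _) ∂∘r-0

    ∂¹∘r : ∂¹ ∘ r ≡ id
    ∂¹∘r = trans (assoc _ _ _) ∂∘r-1

    r∈𝓛 : 𝓛 T r
    r∈𝓛 = r-stable id (𝒜-iso id (id , identityˡ id , identityˡ id)) (idPullback r)

  -- Contraction of the path space onto its constant paths: a path of paths
  -- c γ (in the path object P∂ of ∂⁰_p) from γ to the constant path at ∂⁰ γ,
  -- which is itself constant on constant paths.  Obtained by lifting r_p ∈ 𝓛
  -- against ∂ of P∂.
  module Contraction {E Z} {p : Hom E Z} {ap : 𝒜 p} (Pp : PathObject T p ap)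
      {a∂ : 𝒜 (PathObject.∂⁰ Pp)} (P∂ : PathObject T (PathObject.∂⁰ Pp) a∂) where
    private
      module Pp = PathObjectFacts Pp
      module P∂ = PathObjectFacts P∂
      PP = pb Pp.∂⁰ a∂ Pp.∂⁰
      open Pullback PP using () renaming (π₁ to pr₀; π₂ to pr₁)

      endpoints-commute : Pp.∂⁰ ∘ id ≡ Pp.∂⁰ ∘ (Pp.r ∘ Pp.∂⁰)
      endpoints-commute = trans (identityʳ _) (sym (trans (pullˡ Pp.∂⁰ Pp.∂⁰∘r) (identityˡ _)))

      endpoints : Hom Pp.Path (Pullback.P PP)
      endpoints = pair PP id (Pp.r ∘ Pp.∂⁰) endpoints-commute

      square : P∂.∂ ∘ (P∂.r ∘ Pp.r) ≡ endpoints ∘ Pp.r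
      square = pb-ext PP
        (begin
          pr₀ ∘ (P∂.∂ ∘ (P∂.r ∘ Pp.r)) ≡⟨ sym (assoc _ _ _) ⟩
          P∂.∂⁰ ∘ (P∂.r ∘ Pp.r)        ≡⟨ pullˡ Pp.r P∂.∂⁰∘r ⟩
          id ∘ Pp.r                    ≡⟨ sym (pullˡ Pp.r (pair-π₁ PP _ _ endpoints-commute)) ⟩
          pr₀ ∘ (endpoints ∘ Pp.r)     ∎)
        (begin
          pr₁ ∘ (P∂.∂ ∘ (P∂.r ∘ Pp.r)) ≡⟨ sym (assoc _ _ _) ⟩
          P∂.∂¹ ∘ (P∂.r ∘ Pp.r)        ≡⟨ pullˡ Pp.r P∂.∂¹∘r ⟩
          id ∘ Pp.r                    ≡⟨ identityˡ Pp.r ⟩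
          Pp.r                         ≡⟨ sym (trans (cong (Pp.r ∘_) Pp.∂⁰∘r) (identityʳ Pp.r)) ⟩
          Pp.r ∘ (Pp.∂⁰ ∘ Pp.r)        ≡⟨ sym (assoc _ _ _) ⟩
          (Pp.r ∘ Pp.∂⁰) ∘ Pp.r        ≡⟨ sym (pullˡ Pp.r (pair-π₂ PP _ _ endpoints-commute)) ⟩
          pr₁ ∘ (endpoints ∘ Pp.r)     ∎)

      filler = Pp.r∈𝓛 P∂.∂ P∂.∂∈𝒜 (P∂.r ∘ Pp.r) endpoints square

    c : Hom Pp.Path P∂.Path
    c = proj₁ filler

    c-∘r : c ∘ Pp.r ≡ P∂.r ∘ Pp.r
    c-∘r = proj₁ (proj₂ filler)

    ∂⁰∘c : P∂.∂⁰ ∘ c ≡ id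
    ∂⁰∘c = trans (assoc _ _ _)
             (trans (cong (pr₀ ∘_) (proj₂ (proj₂ filler))) (pair-π₁ PP _ _ endpoints-commute))

    ∂¹∘c : P∂.∂¹ ∘ c ≡ Pp.r ∘ Pp.∂⁰
    ∂¹∘c = trans (assoc _ _ _)
             (trans (cong (pr₁ ∘_) (proj₂ (proj₂ filler))) (pair-π₂ PP _ _ endpoints-commute))

  -- Transport along paths for an 𝒜-arrow q : G → E: a point g of G and a path
  -- α in E ending at q g yield a point of G over the start of α, and constant
  -- paths transport trivially.  This is where stability of r under base
  -- change is used: the "constant path" map j below is such a base change.
  module Transport {E Z} {p : Hom E Z} {ap : 𝒜 p} (Pp : PathObject T p ap)
      {G} (q : Hom G E) (aq : 𝒜 q) where
    open PathObjectFacts Pp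

    K : Pullback C q ∂¹
    K = pb q aq ∂¹

    private
      open Pullback K using () renaming (P to Ko; π₁ to κ₁; π₂ to κ₂)

      aκ₂ : 𝒜 κ₂
      aκ₂ = 𝒜-pb q aq ∂¹ K

      j-commute : q ∘ id ≡ ∂¹ ∘ (r ∘ q)
      j-commute = trans (identityʳ q) (sym (trans (pullˡ q ∂¹∘r) (identityˡ q)))

    j : Hom G Ko
    j = pair K id (r ∘ q) j-commute

    κ₁∘j : κ₁ ∘ j ≡ id
    κ₁∘j = pair-π₁ K id (r ∘ q) j-commute

    κ₂∘j : κ₂ ∘ j ≡ r ∘ q
    κ₂∘j = pair-π₂ K id (r ∘ q) j-commute

    j-baseChange : Pullback C κ₂ r
    j-baseChange = record
      { P = G ; π₁ = j ; π₂ = q ; commute = κ₂∘j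
      ; universal = λ h k e → κ₁ ∘ h , j∘κ₁ h k e , q∘κ₁ h k e
                              , λ u′ e₁ _ → trans (sym (cancel u′)) (cong (κ₁ ∘_) e₁) }
      where
      q∘κ₁ : ∀ {W} (h : Hom W Ko) (k : Hom W E) → κ₂ ∘ h ≡ r ∘ k → q ∘ (κ₁ ∘ h) ≡ k
      q∘κ₁ h k e = begin
        q ∘ (κ₁ ∘ h)  ≡⟨ pullˡ h (Pullback.commute K) ⟩
        (∂¹ ∘ κ₂) ∘ h ≡⟨ assoc _ _ _ ⟩
        ∂¹ ∘ (κ₂ ∘ h) ≡⟨ cong (∂¹ ∘_) e ⟩
        ∂¹ ∘ (r ∘ k)  ≡⟨ pullˡ k ∂¹∘r ⟩
        id ∘ k        ≡⟨ identityˡ k ⟩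
        k             ∎
      j∘κ₁ : ∀ {W} (h : Hom W Ko) (k : Hom W E) → κ₂ ∘ h ≡ r ∘ k → j ∘ (κ₁ ∘ h) ≡ h
      j∘κ₁ h k e = pb-ext K
        (trans (pullˡ (κ₁ ∘ h) κ₁∘j) (identityˡ _))
        (begin
          κ₂ ∘ (j ∘ (κ₁ ∘ h)) ≡⟨ pullˡ (κ₁ ∘ h) κ₂∘j ⟩
          (r ∘ q) ∘ (κ₁ ∘ h)  ≡⟨ assoc _ _ _ ⟩
          r ∘ (q ∘ (κ₁ ∘ h))  ≡⟨ cong (r ∘_) (q∘κ₁ h k e) ⟩
          r ∘ k               ≡⟨ sym e ⟩
          κ₂ ∘ h              ∎)
      cancel : ∀ {W} (u′ : Hom W G) → κ₁ ∘ (j ∘ u′) ≡ u′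
      cancel u′ = trans (pullˡ u′ κ₁∘j) (identityˡ u′)

    j∈𝓛 : 𝓛 T j
    j∈𝓛 = r-stable κ₂ aκ₂ j-baseChange

    private
      start-commute : q ∘ id ≡ (∂⁰ ∘ κ₂) ∘ j
      start-commute = begin
        q ∘ id        ≡⟨ identityʳ q ⟩
        q             ≡⟨ sym (trans (pullˡ q ∂⁰∘r) (identityˡ q)) ⟩
        ∂⁰ ∘ (r ∘ q)  ≡⟨ cong (∂⁰ ∘_) (sym κ₂∘j) ⟩
        ∂⁰ ∘ (κ₂ ∘ j) ≡⟨ sym (assoc _ _ _) ⟩
        (∂⁰ ∘ κ₂) ∘ j ∎

      transport-lift = j∈𝓛 q aq id (∂⁰ ∘ κ₂) start-commute

    transport : Hom Ko G
    transport = proj₁ transport-lift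

    transport∘j : transport ∘ j ≡ id
    transport∘j = proj₁ (proj₂ transport-lift)

    q∘transport : q ∘ transport ≡ ∂⁰ ∘ κ₂
    q∘transport = proj₂ (proj₂ transport-lift)

  -- A strong deformation retract is in 𝓛: if ρ i = id and H is a homotopy
  -- (in any path object on M) from id to i ρ which is constant on i, then i
  -- lifts against every g ∈ 𝒜.  The lift transports the solution u, spread
  -- over M by ρ, back along H.
  retract⇒𝓛 : ∀ {M X Z} {p : Hom M Z} {ap : 𝒜 p} (Pp : PathObject T p ap)
    (i : Hom X M) (ρ : Hom M X) → ρ ∘ i ≡ id →
    (H : Hom M (PathObject.Path Pp)) → PathObject.∂⁰ Pp ∘ H ≡ id →
    PathObject.∂¹ Pp ∘ H ≡ i ∘ ρ → H ∘ i ≡ PathObject.r Pp ∘ i → 𝓛 T i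
  retract⇒𝓛 {M} {X} Pp i ρ ρ∘i H ∂⁰∘H ∂¹∘H H∘i g ag u v square =
    section⇒lift G u i s q∘s s-extends
    where
    open PathObjectFacts Pp
    G = pb g ag v
    open Pullback G using () renaming (π₁ to γ₁; π₂ to qG)
    open Transport Pp qG (𝒜-pb g ag v G)
    open Pullback K using () renaming (π₁ to κ₁; π₂ to κ₂)

    s₀ : Hom X (Pullback.P G)
    s₀ = pair G u i square

    t-commute : qG ∘ (s₀ ∘ ρ) ≡ ∂¹ ∘ H
    t-commute = trans (pullˡ ρ (pair-π₂ G u i square)) (sym ∂¹∘H)

    t : Hom M (Pullback.P K)
    t = pair K (s₀ ∘ ρ) H t-commute

    s : Hom M (Pullback.P G)
    s = transport ∘ t

    q∘s : qG ∘ s ≡ id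
    q∘s = begin
      qG ∘ (transport ∘ t) ≡⟨ pullˡ t q∘transport ⟩
      (∂⁰ ∘ κ₂) ∘ t        ≡⟨ assoc _ _ _ ⟩
      ∂⁰ ∘ (κ₂ ∘ t)        ≡⟨ cong (∂⁰ ∘_) (pair-π₂ K _ H t-commute) ⟩
      ∂⁰ ∘ H               ≡⟨ ∂⁰∘H ⟩
      id                   ∎

    -- on X the path H is constant, so t restricts to j s₀
    t∘i : t ∘ i ≡ j ∘ s₀
    t∘i = pb-ext K
      (begin
        κ₁ ∘ (t ∘ i)  ≡⟨ pullˡ i (pair-π₁ K _ H t-commute) ⟩
        (s₀ ∘ ρ) ∘ i  ≡⟨ assoc _ _ _ ⟩
        s₀ ∘ (ρ ∘ i)  ≡⟨ cong (s₀ ∘_) ρ∘i ⟩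
        s₀ ∘ id       ≡⟨ identityʳ s₀ ⟩
        s₀            ≡⟨ sym (trans (pullˡ s₀ κ₁∘j) (identityˡ s₀)) ⟩
        κ₁ ∘ (j ∘ s₀) ∎)
      (begin
        κ₂ ∘ (t ∘ i)  ≡⟨ pullˡ i (pair-π₂ K _ H t-commute) ⟩
        H ∘ i         ≡⟨ H∘i ⟩
        r ∘ i         ≡⟨ cong (r ∘_) (sym (pair-π₂ G u i square)) ⟩
        r ∘ (qG ∘ s₀) ≡⟨ sym (assoc _ _ _) ⟩
        (r ∘ qG) ∘ s₀ ≡⟨ sym (pullˡ s₀ κ₂∘j) ⟩
        κ₂ ∘ (j ∘ s₀) ∎)

    s-extends : γ₁ ∘ (s ∘ i) ≡ u
    s-extends = begin
      γ₁ ∘ ((transport ∘ t) ∘ i) ≡⟨ cong (γ₁ ∘_) (assoc _ _ _) ⟩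
      γ₁ ∘ (transport ∘ (t ∘ i)) ≡⟨ cong (λ x → γ₁ ∘ (transport ∘ x)) t∘i ⟩
      γ₁ ∘ (transport ∘ (j ∘ s₀)) ≡⟨ cong (γ₁ ∘_) (pullˡ s₀ transport∘j) ⟩
      γ₁ ∘ (id ∘ s₀)             ≡⟨ cong (γ₁ ∘_) (identityˡ s₀) ⟩
      γ₁ ∘ s₀                    ≡⟨ pair-π₁ G u i square ⟩
      u                          ∎

module MappingPathFactorization {o ℓ a : Level} (T : Tribe o ℓ a) (PO : HasPathObjects T)
    (SPO : StablePathObjects T PO) {X Y} (f : Category.Hom (Tribe.C T) X Y) where
  open Tribe T
  open Category C
  open Terminal terminal
  open PullbackLemmas C
  open PathObjectLemmas T
  open ≡-Reasoning

  module PY = PathObjectFacts (PO (! {Y}) (𝒜-! !))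
  YY = pb (! {Y}) (𝒜-! !) (! {Y})
  open Pullback YY using () renaming (π₁ to pr₀; π₂ to pr₁)

  M = pb PY.∂⁰ PY.∂⁰∈𝒜 f
  open Pullback M using () renaming (P to Mo; π₁ to μ₁; π₂ to μ₂)

  μ₂∈𝒜 : 𝒜 μ₂
  μ₂∈𝒜 = 𝒜-pb PY.∂⁰ PY.∂⁰∈𝒜 f M

  private
    i-commute : PY.∂⁰ ∘ (PY.r ∘ f) ≡ f ∘ id
    i-commute = trans (pullˡ f PY.∂⁰∘r) (trans (identityˡ f) (sym (identityʳ f)))

  i : Hom X Mo
  i = pair M (PY.r ∘ f) id i-commute

  μ₁∘i : μ₁ ∘ i ≡ PY.r ∘ f
  μ₁∘i = pair-π₁ M (PY.r ∘ f) id i-commute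

  μ₂∘i : μ₂ ∘ i ≡ id
  μ₂∘i = pair-π₂ M (PY.r ∘ f) id i-commute

  q : Hom Mo Y
  q = PY.∂¹ ∘ μ₁

  q∘i : q ∘ i ≡ f
  q∘i = trans (assoc _ _ _) (trans (cong (PY.∂¹ ∘_) μ₁∘i) (trans (pullˡ f PY.∂¹∘r) (identityˡ f)))

  -- q ∈ 𝓡: lift l against X → 𝟏 to get the X-component, then against
  -- ∂ : Path(Y) → Y × Y to get the path component.
  q∈𝓡 : 𝓡 T q
  q∈𝓡 l l∈𝓛 u v square = d , d∘l , q∘d
    where
    x-lift = l∈𝓛 (! {X}) (𝒜-! !) (μ₂ ∘ u) ! (trans (!-unique _) (sym (!-unique _)))
    x = proj₁ x-lift
    x∘l : x ∘ l ≡ μ₂ ∘ u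
    x∘l = proj₁ (proj₂ x-lift)

    ends-commute : ! ∘ (f ∘ x) ≡ ! ∘ v
    ends-commute = trans (!-unique _) (sym (!-unique _))
    ends = pair YY (f ∘ x) v ends-commute

    path-square : PY.∂ ∘ (μ₁ ∘ u) ≡ ends ∘ l
    path-square = pb-ext YY
      (begin
        pr₀ ∘ (PY.∂ ∘ (μ₁ ∘ u)) ≡⟨ sym (assoc _ _ _) ⟩
        PY.∂⁰ ∘ (μ₁ ∘ u)        ≡⟨ pullˡ u (Pullback.commute M) ⟩
        (f ∘ μ₂) ∘ u            ≡⟨ assoc _ _ _ ⟩
        f ∘ (μ₂ ∘ u)            ≡⟨ cong (f ∘_) (sym x∘l) ⟩
        f ∘ (x ∘ l)             ≡⟨ sym (assoc _ _ _) ⟩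
        (f ∘ x) ∘ l             ≡⟨ sym (pullˡ l (pair-π₁ YY _ v ends-commute)) ⟩
        pr₀ ∘ (ends ∘ l)        ∎)
      (begin
        pr₁ ∘ (PY.∂ ∘ (μ₁ ∘ u)) ≡⟨ sym (assoc _ _ _) ⟩
        PY.∂¹ ∘ (μ₁ ∘ u)        ≡⟨ sym (assoc _ _ _) ⟩
        q ∘ u                   ≡⟨ square ⟩
        v ∘ l                   ≡⟨ sym (pullˡ l (pair-π₂ YY _ v ends-commute)) ⟩
        pr₁ ∘ (ends ∘ l)        ∎)

    γ-lift = l∈𝓛 PY.∂ PY.∂∈𝒜 (μ₁ ∘ u) ends path-square
    γ = proj₁ γ-lift
    ∂∘γ : PY.∂ ∘ γ ≡ ends
    ∂∘γ = proj₂ (proj₂ γ-lift)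

    d-commute : PY.∂⁰ ∘ γ ≡ f ∘ x
    d-commute = trans (assoc _ _ _) (trans (cong (pr₀ ∘_) ∂∘γ) (pair-π₁ YY _ v ends-commute))
    d = pair M γ x d-commute

    d∘l : d ∘ l ≡ u
    d∘l = pb-ext M (trans (pullˡ l (pair-π₁ M γ x d-commute)) (proj₁ (proj₂ γ-lift)))
                   (trans (pullˡ l (pair-π₂ M γ x d-commute)) x∘l)

    q∘d : q ∘ d ≡ v
    q∘d = begin
      (PY.∂¹ ∘ μ₁) ∘ d ≡⟨ assoc _ _ _ ⟩
      PY.∂¹ ∘ (μ₁ ∘ d) ≡⟨ cong (PY.∂¹ ∘_) (pair-π₁ M γ x d-commute) ⟩
      (pr₁ ∘ PY.∂) ∘ γ ≡⟨ assoc _ _ _ ⟩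
      pr₁ ∘ (PY.∂ ∘ γ) ≡⟨ cong (pr₁ ∘_) ∂∘γ ⟩
      pr₁ ∘ ends       ≡⟨ pair-π₂ YY _ v ends-commute ⟩
      v                ∎

  -- The deformation of M onto X: stability of path objects, applied to
  -- p = ∂⁰_Y, turns the contraction of each path μ₁ m onto its starting point
  -- into a path in the fibre direction of μ₂ from m to i (μ₂ m).
  module Pμ = PathObjectFacts (PO μ₂ μ₂∈𝒜)
  module P∂ = PathObjectFacts (PO PY.∂⁰ PY.∂⁰∈𝒜)
  open Contraction (PO (! {Y}) (𝒜-! !)) (PO PY.∂⁰ PY.∂⁰∈𝒜)

  Map = pb P∂.∂⁰ P∂.∂⁰∈𝒜 μ₁
  open Pullback Map using () renaming (P to Mapo; π₁ to pm₁; π₂ to pm₀)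
  MM = pb μ₂ μ₂∈𝒜 μ₂
  open Pullback MM using () renaming (π₁ to fst; π₂ to snd)

  private
    stable = SPO PY.∂⁰ PY.∂⁰∈𝒜 f

    ι : Hom Mapo Pμ.Path
    ι = proj₁ stable

    ι-r : ∀ (m : Hom Mo Mapo) → pm₀ ∘ m ≡ id → pm₁ ∘ m ≡ P∂.r ∘ μ₁ → ι ∘ m ≡ Pμ.r
    ι-r = proj₁ (proj₂ stable)

    ι-∂⁰ : fst ∘ (Pμ.∂ ∘ ι) ≡ pm₀
    ι-∂⁰ = proj₁ (proj₂ (proj₂ stable))

    ι-∂¹-μ₂ : μ₂ ∘ (snd ∘ (Pμ.∂ ∘ ι)) ≡ μ₂ ∘ pm₀
    ι-∂¹-μ₂ = proj₁ (proj₂ (proj₂ (proj₂ stable)))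

    ι-∂¹-μ₁ : μ₁ ∘ (snd ∘ (Pμ.∂ ∘ ι)) ≡ P∂.∂¹ ∘ pm₁
    ι-∂¹-μ₁ = proj₂ (proj₂ (proj₂ (proj₂ stable)))

    cone-commute : ∀ (k : Hom PY.Path P∂.Path) → P∂.∂⁰ ∘ k ≡ id → P∂.∂⁰ ∘ (k ∘ μ₁) ≡ μ₁ ∘ id
    cone-commute k e = trans (pullˡ μ₁ e) (trans (identityˡ _) (sym (identityʳ _)))

    cone : (k : Hom PY.Path P∂.Path) → P∂.∂⁰ ∘ k ≡ id → Hom Mo Mapo
    cone k e = pair Map (k ∘ μ₁) id (cone-commute k e)

    contract = cone c ∂⁰∘c
    refl-cone = cone P∂.r P∂.∂⁰∘r

  H : Hom Mo Pμ.Path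
  H = ι ∘ contract

  ∂⁰∘H : Pμ.∂⁰ ∘ H ≡ id
  ∂⁰∘H = begin
    (fst ∘ Pμ.∂) ∘ (ι ∘ contract) ≡⟨ assoc _ _ _ ⟩
    fst ∘ (Pμ.∂ ∘ (ι ∘ contract)) ≡⟨ cong (fst ∘_) (sym (assoc _ _ _)) ⟩
    fst ∘ ((Pμ.∂ ∘ ι) ∘ contract) ≡⟨ pullˡ contract ι-∂⁰ ⟩
    pm₀ ∘ contract                ≡⟨ pair-π₂ Map _ id (cone-commute c ∂⁰∘c) ⟩
    id                            ∎

  ∂¹∘H : Pμ.∂¹ ∘ H ≡ i ∘ μ₂
  ∂¹∘H = trans (assoc _ _ _) (trans (cong (snd ∘_) (sym (assoc _ _ _)))
           (trans (sym (assoc _ _ _)) (pb-ext M on-μ₁ on-μ₂)))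
    where
    end = snd ∘ (Pμ.∂ ∘ ι)
    on-μ₁ : μ₁ ∘ (end ∘ contract) ≡ μ₁ ∘ (i ∘ μ₂)
    on-μ₁ = begin
      μ₁ ∘ (end ∘ contract)      ≡⟨ pullˡ contract ι-∂¹-μ₁ ⟩
      (P∂.∂¹ ∘ pm₁) ∘ contract   ≡⟨ assoc _ _ _ ⟩
      P∂.∂¹ ∘ (pm₁ ∘ contract)   ≡⟨ cong (P∂.∂¹ ∘_) (pair-π₁ Map _ id (cone-commute c ∂⁰∘c)) ⟩
      P∂.∂¹ ∘ (c ∘ μ₁)           ≡⟨ pullˡ μ₁ ∂¹∘c ⟩
      (PY.r ∘ PY.∂⁰) ∘ μ₁        ≡⟨ assoc _ _ _ ⟩
      PY.r ∘ (PY.∂⁰ ∘ μ₁)        ≡⟨ cong (PY.r ∘_) (Pullback.commute M) ⟩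
      PY.r ∘ (f ∘ μ₂)            ≡⟨ sym (assoc _ _ _) ⟩
      (PY.r ∘ f) ∘ μ₂            ≡⟨ sym (pullˡ μ₂ μ₁∘i) ⟩
      μ₁ ∘ (i ∘ μ₂)              ∎
    on-μ₂ : μ₂ ∘ (end ∘ contract) ≡ μ₂ ∘ (i ∘ μ₂)
    on-μ₂ = begin
      μ₂ ∘ (end ∘ contract)      ≡⟨ pullˡ contract ι-∂¹-μ₂ ⟩
      (μ₂ ∘ pm₀) ∘ contract      ≡⟨ assoc _ _ _ ⟩
      μ₂ ∘ (pm₀ ∘ contract)      ≡⟨ cong (μ₂ ∘_) (pair-π₂ Map _ id (cone-commute c ∂⁰∘c)) ⟩
      μ₂ ∘ id                    ≡⟨ identityʳ _ ⟩
      μ₂                         ≡⟨ sym (trans (pullˡ μ₂ μ₂∘i) (identityˡ _)) ⟩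
      μ₂ ∘ (i ∘ μ₂)              ∎

  -- on constant paths the contraction is constant, so H is constant on i
  H∘i : H ∘ i ≡ Pμ.r ∘ i
  H∘i = begin
    (ι ∘ contract) ∘ i  ≡⟨ assoc _ _ _ ⟩
    ι ∘ (contract ∘ i)  ≡⟨ cong (ι ∘_) contract∘i ⟩
    ι ∘ (refl-cone ∘ i) ≡⟨ pullˡ i (ι-r refl-cone (pair-π₂ Map _ id (cone-commute P∂.r P∂.∂⁰∘r))
                                                  (pair-π₁ Map _ id (cone-commute P∂.r P∂.∂⁰∘r))) ⟩
    Pμ.r ∘ i            ∎
    where
    contract∘i : contract ∘ i ≡ refl-cone ∘ i
    contract∘i = pb-ext Map
      (begin
        pm₁ ∘ (contract ∘ i)  ≡⟨ pullˡ i (pair-π₁ Map _ id (cone-commute c ∂⁰∘c)) ⟩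
        (c ∘ μ₁) ∘ i          ≡⟨ assoc _ _ _ ⟩
        c ∘ (μ₁ ∘ i)          ≡⟨ cong (c ∘_) μ₁∘i ⟩
        c ∘ (PY.r ∘ f)        ≡⟨ pullˡ f c-∘r ⟩
        (P∂.r ∘ PY.r) ∘ f     ≡⟨ assoc _ _ _ ⟩
        P∂.r ∘ (PY.r ∘ f)     ≡⟨ cong (P∂.r ∘_) (sym μ₁∘i) ⟩
        P∂.r ∘ (μ₁ ∘ i)       ≡⟨ sym (assoc _ _ _) ⟩
        (P∂.r ∘ μ₁) ∘ i       ≡⟨ sym (pullˡ i (pair-π₁ Map _ id (cone-commute P∂.r P∂.∂⁰∘r))) ⟩
        pm₁ ∘ (refl-cone ∘ i) ∎)
      (trans (pullˡ i (pair-π₂ Map _ id (cone-commute c ∂⁰∘c)))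
             (sym (pullˡ i (pair-π₂ Map _ id (cone-commute P∂.r P∂.∂⁰∘r)))))

  i∈𝓛 : 𝓛 T i
  i∈𝓛 = retract⇒𝓛 (PO μ₂ μ₂∈𝒜) i μ₂ μ₂∘i H ∂⁰∘H ∂¹∘H H∘i

theorem2p8 : ∀ {o ℓ a : Level} (T : Tribe o ℓ a) (PO : HasPathObjects T) →
    StablePathObjects T PO → IsWFS (Tribe.C T) (𝓛 T) (𝓡 T)
theorem2p8 T PO SPO = record
  { factor  = λ f → let open MappingPathFactorization T PO SPO f
                    in Pullback.P M , i , q , i∈𝓛 , q∈𝓡 , q∘i
  ; 𝓡⇒rlp = λ g g∈𝓡 → g∈𝓡
  ; rlp⇒𝓡 = λ g g-rlp → g-rlp
  ; 𝓛⇒llp = λ f f∈𝓛 g g∈𝓡 → g∈𝓡 f f∈𝓛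
  -- every arrow of 𝒜 is in 𝓡, so l.l.p. against 𝓡 implies membership in 𝓛
  ; llp⇒𝓛 = λ f f-llp g g∈𝒜 → f-llp g (λ l l∈𝓛 → l∈𝓛 g g∈𝒜)
  }
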